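{- Let $S$ be a numerical set. Then $A(S)\subseteq A(S^{(2)})$.
   Context: $\mathbb{N}=\{0,1,2,\dots\}$. A numerical set is a subset $S\subseteq\mathbb{N}$ with $0\in S$ and $\mathbb{N}\setminus S$ finite. Its gaps are the elements of $\mathbb{N}\setminus S$, and $F(S)$ is its largest gap. The associated semigroup is $A(S)=\{s\in S\mid s+S\subseteq S\}$. Young diagram of $S$: it has one left-justified row for each gap $\ell$. The top row corresponds to $F(S)$, and the gaps decrease going down. The row for $\ell$ has length $|\{s\in S\mid s<\ell\}|$. This is a bijection between numerical sets and Young diagrams, with $\mathbb{N}$ corresponding to the empty diagram. The complement of a Young diagram with rows $\lambda_1\ge\dots\ge\lambda_g$ has rows $\lambda_1-\lambda_g\ge\dots\ge\lambda_1-\lambda_1$, zero rows being discarded. Geometrically, this is the rest of the $g\times\lambda_1$ rectangle rotated by $180^\circ$. The complement $\widetilde{S}$ is the numerical set whose Young diagram is the complement of that of $S$; in particular $\widetilde{\mathbb{N}}=\mathbb{N}$. Iterated complements: $S^{(0)}=S$, $S^{(i+1)}=\widetilde{S^{(i)}}$, so $S^{(2)}=\widetilde{\widetilde{S}}$. -}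

module Defs where

open import Data.Bool using (Bool; true; false; not; _∨_; if_then_else_)
open import Data.Nat using (ℕ; zero; suc; _+_; _∸_; _≤_; _⊔_; _≡ᵇ_; s≤s; z≤n)
open import Data.Nat.Properties using (≤-trans; m≤m⊔n; m≤n⊔m; ≤-refl; n≤1+n; m≤m+n; <-irrefl; ≡ᵇ⇒≡)
open import Data.List using (List; []; _∷_; reverse; map; length)
open import Data.Product using (_×_)
open import Relation.Binary.PropositionalEquality using (_≡_; refl; sym; subst)
open import Data.Empty using (⊥-elim)
open import Data.Bool using (T)
open import Data.Unit using (tt)

record NumericalSet : Set where
  field
    mem      : ℕ → Bool
    bound    : ℕ
    zero∈    : mem 0 ≡ true
    cofinite : ∀ n → bound ≤ n → mem n ≡ true

open NumericalSet public

infix 4 _∈ₛ_ _∈A_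

_∈ₛ_ : ℕ → NumericalSet → Set
n ∈ₛ S = mem S n ≡ true

_∈A_ : ℕ → NumericalSet → Set
a ∈A S = (a ∈ₛ S) × (∀ s → s ∈ₛ S → (a + s) ∈ₛ S)

gapsBelow : (ℕ → Bool) → ℕ → List ℕ
gapsBelow p zero    = []
gapsBelow p (suc n) = if p n then gapsBelow p n else n ∷ gapsBelow p n

gaps : NumericalSet → List ℕ
gaps S = gapsBelow (mem S) (bound S)

countBelow : (ℕ → Bool) → ℕ → ℕ
countBelow p zero    = zero
countBelow p (suc n) = if p n then suc (countBelow p n) else countBelow p n

-- Young diagram: row lengths, top row (for F(S)) first.
youngDiagram : NumericalSet → List ℕ
youngDiagram S = map (countBelow (mem S)) (gaps S)

dropZeros : List ℕ → List ℕ
dropZeros []          = []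
dropZeros (zero ∷ xs) = dropZeros xs
dropZeros (suc x ∷ xs) = suc x ∷ dropZeros xs

complementDiagram : List ℕ → List ℕ
complementDiagram []            = []
complementDiagram (l₁ ∷ rows) = dropZeros (map (l₁ ∸_) (reverse (l₁ ∷ rows)))

-- From a Young diagram back to its numerical set.
-- The gap of the row with length λ having r rows below it is λ + r
-- (= #{s ∈ S below it} + #{gaps below it}).

diagramGaps : List ℕ → List ℕ
diagramGaps []           = []
diagramGaps (l ∷ rows) = (l + length rows) ∷ diagramGaps rows

elemᵇ : ℕ → List ℕ → Bool
elemᵇ n []       = false
elemᵇ n (x ∷ xs) = (n ≡ᵇ x) ∨ elemᵇ n xs

maxL : List ℕ → ℕ
maxL []       = 0
maxL (x ∷ xs) = x ⊔ maxL xs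

private
  elem-max : ∀ n xs → elemᵇ n xs ≡ true → n ≤ maxL xs
  elem-max n (x ∷ xs) h with n ≡ᵇ x in eq
  ... | true  = subst (_≤ x ⊔ maxL xs) (sym (≡ᵇ⇒≡ n x (subst T (sym eq) tt))) (m≤m⊔n x (maxL xs))
  ... | false = ≤-trans (elem-max n xs h) (m≤n⊔m x (maxL xs))

  notElem-big : ∀ xs n → suc (maxL xs) ≤ n → not (elemᵇ n xs) ≡ true
  notElem-big xs n h with elemᵇ n xs in eq
  ... | false = refl
  ... | true  = ⊥-elim (<-irrefl refl (≤-trans h (elem-max n xs eq)))

  zero∉ : ∀ xs → not (elemᵇ 0 (diagramGaps (dropZeros xs))) ≡ true
  zero∉ [] = refl
  zero∉ (zero ∷ xs) = zero∉ xs
  zero∉ (suc x ∷ xs) = zero∉ xs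

  zero∉c : ∀ ys → not (elemᵇ 0 (diagramGaps (complementDiagram ys))) ≡ true
  zero∉c [] = refl
  zero∉c (l ∷ rows) = zero∉ (map (l ∸_) (reverse (l ∷ rows)))

-- The numerical set whose Young diagram is the complement of that of S.
complement : NumericalSet → NumericalSet
complement S = record
  { mem      = λ n → not (elemᵇ n gs)
  ; bound    = suc (maxL gs)
  ; zero∈    = zero∉c (youngDiagram S)
  ; cofinite = notElem-big gs
  }
  where
  gs : List ℕ
  gs = diagramGaps (complementDiagram (youngDiagram S))

iterComplement : ℕ → NumericalSet → NumericalSet
iterComplement zero    S = S
iterComplement (suc i) S = complement (iterComplement i S)

module Submission where

-- Write c(m) for the number of elements of S below m, so that the row of the
-- Young diagram belonging to a gap m has length c(m), and a row with r rows
-- below it belongs to the gap (row length) + r. Complementing twice discards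
-- the rows of maximal length l and of minimal length z and shortens the others
-- by z. Fix q ∈ S with c(q) = z. The gap of S⁽²⁾ coming from the row of a gap
-- m with z < c(m) < l is then exactly m − q, since every number in [q, m) is
-- either an element of S counted in c(m) − z or a gap whose row survives. So
-- the gaps of S⁽²⁾ are the m − q for the gaps m of S with z < c(m) < l.
-- Now let a + S ⊆ S. If a = m − q, then m = a + q ∈ S, which is absurd. If
-- a + s = m − q, then q + s is a gap of S (because a + (q + s) = m is one)
-- lying between q and m, so s = (q + s) − q is a gap of S⁽²⁾ as well.

open import Data.Bool using (Bool; true; false; not)
open import Data.Bool.Properties using (∨-zeroʳ; T-≡; not-injective; not-¬; ¬-not) renaming (_≟_ to _≟ᵇ_)
open import Data.Empty using (⊥-elim)
open import Data.List using (List; []; _∷_; _++_; _∷ʳ_; [_]; map; filter; length; reverse)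
open import Data.List.Properties
  using (unfold-reverse; reverse-involutive; reverse-map; map-∘; map-cong-local; map-++;
         filter-++; filter-accept; filter-reject; ++-identityʳ)
open import Data.List.Membership.Propositional using (_∈_; _∉_)
open import Data.List.Relation.Binary.Subset.Propositional using (_⊆_)
open import Data.List.Relation.Unary.All as All using (All; []; _∷_)
import Data.List.Relation.Unary.All.Properties as All
open import Data.List.Relation.Unary.AllPairs as AllPairs using (AllPairs; []; _∷_)
import Data.List.Relation.Unary.AllPairs.Properties as AllPairs
open import Data.List.Relation.Unary.Any using (here; there)
import Data.List.Relation.Unary.Any.Properties as Any
open import Data.Nat
open import Data.Nat.Properties
open import Data.Product using (_×_; _,_; proj₁; proj₂; ∃₂; ∃-syntax; map₁; map₂)
open import Data.Sum using (inj₁; inj₂)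
open import Function using (_∘_; id; flip; Equivalence)
open import Relation.Binary.PropositionalEquality hiding ([_])
open import Relation.Nullary using (¬_; yes; no; Dec)
open import Relation.Nullary.Decidable using (_×-dec_)
open import Relation.Unary using (Decidable)

open import Defs

NonIncreasing NonDecreasing StrictlyDecreasing : List ℕ → Set
NonIncreasing      = AllPairs _≥_
NonDecreasing      = AllPairs _≤_
StrictlyDecreasing = AllPairs _>_

elemᵇ⇒∈ : ∀ {n} xs → elemᵇ n xs ≡ true → n ∈ xs
elemᵇ⇒∈ {n} (x ∷ xs) h with n ≡ᵇ x in eq
... | true  = here (≡ᵇ⇒≡ n x (Equivalence.from T-≡ eq))
... | false = there (elemᵇ⇒∈ xs h)

∈⇒elemᵇ : ∀ {n xs} → n ∈ xs → elemᵇ n xs ≡ true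
∈⇒elemᵇ {n} (here refl) rewrite Equivalence.to T-≡ (≡⇒≡ᵇ n n refl) = refl
∈⇒elemᵇ {n} {x ∷ _} (there n∈xs) rewrite ∈⇒elemᵇ n∈xs = ∨-zeroʳ (n ≡ᵇ x)

∉⇒not-elemᵇ : ∀ {n} xs → n ∉ xs → not (elemᵇ n xs) ≡ true
∉⇒not-elemᵇ {n} xs n∉xs with elemᵇ n xs in eq
... | false = refl
... | true  = ⊥-elim (n∉xs (elemᵇ⇒∈ xs eq))

not-elemᵇ⇒∉ : ∀ {n xs} → not (elemᵇ n xs) ≡ true → n ∉ xs
not-elemᵇ⇒∉ h n∈xs with () ← trans (sym h) (cong not (∈⇒elemᵇ n∈xs))

∈⇒≤maxL : ∀ {n xs} → n ∈ xs → n ≤ maxL xs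
∈⇒≤maxL {xs = x ∷ xs} (here refl)  = m≤m⊔n x (maxL xs)
∈⇒≤maxL {xs = x ∷ xs} (there n∈xs) = ≤-trans (∈⇒≤maxL n∈xs) (m≤n⊔m x (maxL xs))

strictlyDecreasing-unique : ∀ {xs ys} → StrictlyDecreasing xs → StrictlyDecreasing ys →
                            xs ⊆ ys → ys ⊆ xs → xs ≡ ys
strictlyDecreasing-unique [] [] _ _ = refl
strictlyDecreasing-unique [] (_ ∷ _) _ ys⊆xs with () ← ys⊆xs (here refl)
strictlyDecreasing-unique (_ ∷ _) [] xs⊆ys _ with () ← xs⊆ys (here refl)
strictlyDecreasing-unique (x>xs ∷ xs↓) (y>ys ∷ ys↓) xs⊆ys ys⊆xs =
  cong₂ _∷_ x≡y (strictlyDecreasing-unique xs↓ ys↓ (tail-⊆ x≡y x>xs xs⊆ys) (tail-⊆ (sym x≡y) y>ys ys⊆xs))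
  where
  ≤head : ∀ {z x xs} → All (_< x) xs → z ∈ x ∷ xs → z ≤ x
  ≤head _    (here refl)  = ≤-refl
  ≤head x>xs (there z∈xs) = <⇒≤ (All.lookup x>xs z∈xs)

  x≡y = ≤-antisym (≤head y>ys (xs⊆ys (here refl))) (≤head x>xs (ys⊆xs (here refl)))

  tail-⊆ : ∀ {x y xs ys} → x ≡ y → All (_< x) xs → x ∷ xs ⊆ y ∷ ys → xs ⊆ ys
  tail-⊆ refl x>xs ⊆ z∈xs with ⊆ (there z∈xs)
  ... | here refl   = ⊥-elim (<-irrefl refl (All.lookup x>xs z∈xs))
  ... | there z∈ys = z∈ys

All-reverse⁺ : ∀ {A : Set} {P : A → Set} {xs} → All P xs → All P (reverse xs)
All-reverse⁺ ps = All.tabulate (All.lookup ps ∘ Any.reverse⁻)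

AllPairs-reverse⁺ : ∀ {A : Set} {R : A → A → Set} {xs} → AllPairs R xs → AllPairs (flip R) (reverse xs)
AllPairs-reverse⁺ [] = []
AllPairs-reverse⁺ {xs = x ∷ xs} (Rx ∷ Rxs) rewrite unfold-reverse x xs =
  AllPairs.++⁺ (AllPairs-reverse⁺ Rxs) ([] ∷ []) (All.map (_∷ []) (All-reverse⁺ Rx))

filter-reverse : ∀ {A : Set} {P : A → Set} (P? : Decidable P) xs →
                 filter P? (reverse xs) ≡ reverse (filter P? xs)
filter-reverse P? [] = refl
filter-reverse {P = P} P? (x ∷ xs) = begin
  filter P? (reverse (x ∷ xs))               ≡⟨ cong (filter P?) (unfold-reverse x xs) ⟩
  filter P? (reverse xs ++ [ x ])            ≡⟨ filter-++ P? (reverse xs) [ x ] ⟩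
  filter P? (reverse xs) ++ filter P? [ x ]  ≡⟨ cong (_++ filter P? [ x ]) (filter-reverse P? xs) ⟩
  reverse (filter P? xs) ++ filter P? [ x ]  ≡⟨ snoc (P? x) ⟩
  reverse (filter P? (x ∷ xs))               ∎
  where
  open ≡-Reasoning
  snoc : Dec (P x) → reverse (filter P? xs) ++ filter P? [ x ] ≡ reverse (filter P? (x ∷ xs))
  snoc (yes px) rewrite filter-accept P? {xs = []} px | filter-accept P? {xs = xs} px =
    sym (unfold-reverse x (filter P? xs))
  snoc (no ¬px) rewrite filter-reject P? {xs = []} ¬px | filter-reject P? {xs = xs} ¬px =
    ++-identityʳ _

dropZeros-accept : ∀ {x} xs → 0 < x → dropZeros (x ∷ xs) ≡ x ∷ dropZeros xs
dropZeros-accept {suc _} _ _ = refl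

dropZeros-∷ʳ-0 : ∀ xs → dropZeros (xs ∷ʳ 0) ≡ dropZeros xs
dropZeros-∷ʳ-0 []           = refl
dropZeros-∷ʳ-0 (zero ∷ xs)  = dropZeros-∷ʳ-0 xs
dropZeros-∷ʳ-0 (suc x ∷ xs) = cong (suc x ∷_) (dropZeros-∷ʳ-0 xs)

dropZeros-map-∷ʳ : ∀ (f : ℕ → ℕ) xs {x} → f x ≡ 0 → dropZeros (map f (xs ∷ʳ x)) ≡ dropZeros (map f xs)
dropZeros-map-∷ʳ f xs {x} fx≡0 = begin
  dropZeros (map f (xs ∷ʳ x))   ≡⟨ cong dropZeros (map-++ f xs [ x ]) ⟩
  dropZeros (map f xs ∷ʳ f x)   ≡⟨ cong (dropZeros ∘ (map f xs ∷ʳ_)) fx≡0 ⟩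
  dropZeros (map f xs ∷ʳ 0)     ≡⟨ dropZeros-∷ʳ-0 (map f xs) ⟩
  dropZeros (map f xs)          ∎
  where open ≡-Reasoning

dropZeros-map-∸ : ∀ l xs → dropZeros (map (l ∸_) xs) ≡ map (l ∸_) (filter (_<? l) xs)
dropZeros-map-∸ l [] = refl
dropZeros-map-∸ l (x ∷ xs) with x <? l
... | yes x<l = begin
  dropZeros (l ∸ x ∷ map (l ∸_) xs)          ≡⟨ dropZeros-accept _ (m<n⇒0<n∸m x<l) ⟩
  l ∸ x ∷ dropZeros (map (l ∸_) xs)          ≡⟨ cong (l ∸ x ∷_) (dropZeros-map-∸ l xs) ⟩
  map (l ∸_) (x ∷ filter (_<? l) xs)         ≡⟨ cong (map (l ∸_)) (filter-accept (_<? l) x<l) ⟨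
  map (l ∸_) (filter (_<? l) (x ∷ xs))       ∎
  where open ≡-Reasoning
... | no  x≮l rewrite m≤n⇒m∸n≡0 (≮⇒≥ x≮l) =
  trans (dropZeros-map-∸ l xs) (cong (map (l ∸_)) (sym (filter-reject (_<? l) x≮l)))

-- Counting members and gaps below n

module _ (p : ℕ → Bool) where

  gapsBelow-gap : ∀ {n} → p n ≡ false → gapsBelow p (suc n) ≡ n ∷ gapsBelow p n
  gapsBelow-gap pn rewrite pn = refl

  countBelow-member : ∀ {n} → p n ≡ true → countBelow p (suc n) ≡ suc (countBelow p n)
  countBelow-member pn rewrite pn = refl

  countBelow-gap : ∀ {n} → p n ≡ false → countBelow p (suc n) ≡ countBelow p n
  countBelow-gap pn rewrite pn = refl

  ∈-gapsBelow⁻ : ∀ n {m} → m ∈ gapsBelow p n → m < n × p m ≡ false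
  ∈-gapsBelow⁻ (suc n) m∈ with p n in pn
  ... | true                 = map₁ m<n⇒m<1+n (∈-gapsBelow⁻ n m∈)
  ∈-gapsBelow⁻ (suc n) (here refl)  | false = ≤-refl , pn
  ∈-gapsBelow⁻ (suc n) (there m∈) | false = map₁ m<n⇒m<1+n (∈-gapsBelow⁻ n m∈)

  ∈-gapsBelow⁺ : ∀ n {m} → m < n → p m ≡ false → m ∈ gapsBelow p n
  ∈-gapsBelow⁺ (suc n) m<1+n pm with m≤n⇒m<n∨m≡n (≤-pred m<1+n) | p n in pn
  ... | inj₁ m<n  | true  = ∈-gapsBelow⁺ n m<n pm
  ... | inj₁ m<n  | false = there (∈-gapsBelow⁺ n m<n pm)
  ... | inj₂ refl | false = here refl
  ... | inj₂ refl | true  with () ← trans (sym pn) pm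

  gapsBelow-strictlyDecreasing : ∀ n → StrictlyDecreasing (gapsBelow p n)
  gapsBelow-strictlyDecreasing zero = []
  gapsBelow-strictlyDecreasing (suc n) with p n
  ... | true  = gapsBelow-strictlyDecreasing n
  ... | false = All.tabulate (λ m∈ → proj₁ (∈-gapsBelow⁻ n m∈)) ∷ gapsBelow-strictlyDecreasing n

  countBelow+length-gapsBelow : ∀ n → countBelow p n + length (gapsBelow p n) ≡ n
  countBelow+length-gapsBelow zero = refl
  countBelow+length-gapsBelow (suc n) with p n
  ... | true  = cong suc (countBelow+length-gapsBelow n)
  ... | false = trans (+-suc _ _) (cong suc (countBelow+length-gapsBelow n))

  countBelow-≤-suc : ∀ n → countBelow p n ≤ countBelow p (suc n)
  countBelow-≤-suc n with p n
  ... | true  = n≤1+n _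
  ... | false = ≤-refl

  countBelow-mono : ∀ {m n} → m ≤ n → countBelow p m ≤ countBelow p n
  countBelow-mono {n = zero} z≤n = ≤-refl
  countBelow-mono {n = suc n} m≤1+n with m≤n⇒m<n∨m≡n m≤1+n
  ... | inj₁ m<1+n = ≤-trans (countBelow-mono (≤-pred m<1+n)) (countBelow-≤-suc n)
  ... | inj₂ refl  = ≤-refl

  countBelow-<⇒< : ∀ {m n} → countBelow p m < countBelow p n → m < n
  countBelow-<⇒< cm<cn = ≰⇒> (λ n≤m → <⇒≱ cm<cn (countBelow-mono n≤m))

  countBelow-member-< : ∀ {q m} → p q ≡ true → q < m → countBelow p q < countBelow p m
  countBelow-member-< {m = m} pq q<m = subst (_≤ countBelow p m) (countBelow-member pq) (countBelow-mono q<m)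

  countBelow-attains : ∀ n {z} → z < countBelow p n → ∃[ q ] q < n × p q ≡ true × countBelow p q ≡ z
  countBelow-attains (suc n) {z} z<c with p n in pn
  ... | false = map₂ (map₁ m<n⇒m<1+n) (countBelow-attains n z<c)
  ... | true with z <? countBelow p n
  ...   | yes z<c′ = map₂ (map₁ m<n⇒m<1+n) (countBelow-attains n z<c′)
  ...   | no  z≮c′ = n , ≤-refl , pn , ≤-antisym (≮⇒≥ z≮c′) (≤-pred z<c)

-- Young diagrams and complements

rowsOfGaps : List ℕ → List ℕ
rowsOfGaps []       = []
rowsOfGaps (g ∷ gs) = (g ∸ length gs) ∷ rowsOfGaps gs

map-countBelow-gapsBelow : ∀ p n → map (countBelow p) (gapsBelow p n) ≡ rowsOfGaps (gapsBelow p n)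
map-countBelow-gapsBelow p zero = refl
map-countBelow-gapsBelow p (suc n) with p n
... | true  = map-countBelow-gapsBelow p n
... | false = cong₂ _∷_ row (map-countBelow-gapsBelow p n)
  where
  row : countBelow p n ≡ n ∸ length (gapsBelow p n)
  row = trans (sym (m+n∸n≡m (countBelow p n) (length (gapsBelow p n))))
              (cong (_∸ length (gapsBelow p n)) (countBelow+length-gapsBelow p n))

length-diagramGaps : ∀ D → length (diagramGaps D) ≡ length D
length-diagramGaps []      = refl
length-diagramGaps (_ ∷ D) = cong suc (length-diagramGaps D)

rowsOfGaps-diagramGaps : ∀ D → rowsOfGaps (diagramGaps D) ≡ D
rowsOfGaps-diagramGaps []      = refl
rowsOfGaps-diagramGaps (d ∷ D) =
  cong₂ _∷_ (trans (cong (d + length D ∸_) (length-diagramGaps D)) (m+n∸n≡m d (length D)))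
            (rowsOfGaps-diagramGaps D)

diagramGaps-< : ∀ {d D} → NonIncreasing (d ∷ D) → All (_< d + length D) (diagramGaps D)
diagramGaps-< {D = []} _ = []
diagramGaps-< {d} {e ∷ E} ((e≤d ∷ _) ∷ e∷E↓) =
  e+E<d+1+E ∷ All.map (λ x<e+E → <-trans x<e+E e+E<d+1+E) (diagramGaps-< e∷E↓)
  where
  e+E<d+1+E : e + length E < d + suc (length E)
  e+E<d+1+E = subst (e + length E <_) (sym (+-suc d (length E))) (s≤s (+-monoˡ-≤ (length E) e≤d))

diagramGaps-strictlyDecreasing : ∀ {D} → NonIncreasing D → StrictlyDecreasing (diagramGaps D)
diagramGaps-strictlyDecreasing []           = []
diagramGaps-strictlyDecreasing D↓@(_ ∷ D′↓) = diagramGaps-< D↓ ∷ diagramGaps-strictlyDecreasing D′↓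

youngDiagram-nonIncreasing : ∀ X → NonIncreasing (youngDiagram X)
youngDiagram-nonIncreasing X =
  AllPairs.map⁺ (AllPairs.map (countBelow-mono (mem X) ∘ <⇒≤) (gapsBelow-strictlyDecreasing (mem X) (bound X)))

complementDiagram-∷ : ∀ d D → complementDiagram (d ∷ D) ≡ dropZeros (map (d ∸_) (reverse D))
complementDiagram-∷ d D = trans (cong (dropZeros ∘ map (d ∸_)) (unfold-reverse d D))
                                (dropZeros-map-∷ʳ (d ∸_) (reverse D) (n∸n≡0 d))

complementDiagram-∷-filter : ∀ l L → complementDiagram (l ∷ L) ≡ map (l ∸_) (reverse (filter (_<? l) L))
complementDiagram-∷-filter l L = begin
  complementDiagram (l ∷ L)                  ≡⟨ complementDiagram-∷ l L ⟩
  dropZeros (map (l ∸_) (reverse L))         ≡⟨ dropZeros-map-∸ l (reverse L) ⟩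
  map (l ∸_) (filter (_<? l) (reverse L))    ≡⟨ cong (map (l ∸_)) (filter-reverse (_<? l) L) ⟩
  map (l ∸_) (reverse (filter (_<? l) L))    ∎
  where open ≡-Reasoning

complementDiagram-nonIncreasing : ∀ {L} → NonIncreasing L → NonIncreasing (complementDiagram L)
complementDiagram-nonIncreasing []                  = []
complementDiagram-nonIncreasing {l ∷ L} (_ ∷ L↓) rewrite complementDiagram-∷-filter l L =
  AllPairs.map⁺ (AllPairs.map (∸-monoʳ-≤ l) (AllPairs-reverse⁺ (AllPairs.filter⁺ (_<? l) L↓)))

gapsBelow-diagramGaps : ∀ {D} → NonIncreasing D →
  let gs = diagramGaps D in gapsBelow (λ n → not (elemᵇ n gs)) (suc (maxL gs)) ≡ gs
gapsBelow-diagramGaps {D} D↓ = strictlyDecreasing-unique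
  (gapsBelow-strictlyDecreasing p (suc (maxL gs)))
  (diagramGaps-strictlyDecreasing D↓)
  (λ g∈ → elemᵇ⇒∈ gs (not-injective (proj₂ (∈-gapsBelow⁻ p (suc (maxL gs)) g∈))))
  (λ g∈ → ∈-gapsBelow⁺ p (suc (maxL gs)) (s≤s (∈⇒≤maxL g∈)) (cong not (∈⇒elemᵇ g∈)))
  where
  gs = diagramGaps D
  p  = λ n → not (elemᵇ n gs)

youngDiagram-complement : ∀ X → youngDiagram (complement X) ≡ complementDiagram (youngDiagram X)
youngDiagram-complement X = begin
  youngDiagram (complement X)          ≡⟨ map-countBelow-gapsBelow (mem (complement X)) (bound (complement X)) ⟩
  rowsOfGaps (gaps (complement X))     ≡⟨ cong rowsOfGaps (gapsBelow-diagramGaps D↓) ⟩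
  rowsOfGaps (diagramGaps D)           ≡⟨ rowsOfGaps-diagramGaps D ⟩
  D                                    ∎
  where
  open ≡-Reasoning
  D  = complementDiagram (youngDiagram X)
  D↓ = complementDiagram-nonIncreasing (youngDiagram-nonIncreasing X)

[l∸z]∸[l∸y]≡y∸z : ∀ {z y l} → z ≤ y → y ≤ l → (l ∸ z) ∸ (l ∸ y) ≡ y ∸ z
[l∸z]∸[l∸y]≡y∸z {zero}              _         y≤l       = m∸[m∸n]≡n y≤l
[l∸z]∸[l∸y]≡y∸z {suc _} {suc _} {suc _} (s≤s z≤y) (s≤s y≤l) = [l∸z]∸[l∸y]≡y∸z z≤y y≤l

complementDiagram-map-∸ : ∀ {l z R} → All (λ y → z ≤ y × y ≤ l) R →
  complementDiagram (map (l ∸_) (z ∷ R)) ≡ dropZeros (map (_∸ z) (reverse (z ∷ R)))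
complementDiagram-map-∸ {l} {z} {R} z≤R≤l = begin
  complementDiagram (l ∸ z ∷ map (l ∸_) R)                 ≡⟨ complementDiagram-∷ (l ∸ z) (map (l ∸_) R) ⟩
  dropZeros (map (l ∸ z ∸_) (reverse (map (l ∸_) R)))     ≡⟨ cong (dropZeros ∘ map (l ∸ z ∸_)) (reverse-map (l ∸_) R) ⟨
  dropZeros (map (l ∸ z ∸_) (map (l ∸_) (reverse R)))     ≡⟨ cong dropZeros (map-∘ (reverse R)) ⟨
  dropZeros (map (λ y → l ∸ z ∸ (l ∸ y)) (reverse R))     ≡⟨ cong dropZeros (map-cong-local (All-reverse⁺ flipped)) ⟩
  dropZeros (map (_∸ z) (reverse R))                       ≡⟨ dropZeros-map-∷ʳ (_∸ z) (reverse R) (n∸n≡0 z) ⟨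
  dropZeros (map (_∸ z) (reverse R ∷ʳ z))                  ≡⟨ cong (dropZeros ∘ map (_∸ z)) (unfold-reverse z R) ⟨
  dropZeros (map (_∸ z) (reverse (z ∷ R)))                 ∎
  where
  open ≡-Reasoning
  flipped = All.map (λ (z≤y , y≤l) → [l∸z]∸[l∸y]≡y∸z z≤y y≤l) z≤R≤l

complementDiagram-ascending : ∀ {l} xs → NonDecreasing xs → All (_≤ l) xs →
  ∃[ z ] complementDiagram (map (l ∸_) xs) ≡ dropZeros (map (_∸ z) (reverse xs))
complementDiagram-ascending []      _         _          = 0 , refl
complementDiagram-ascending (z ∷ R) (z≤R ∷ _) (_ ∷ R≤l) = z , complementDiagram-map-∸ (All.zipWith id (z≤R , R≤l))

complementDiagram² : ∀ {L} → NonIncreasing L →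
  ∃₂ λ z l → complementDiagram (complementDiagram L) ≡ dropZeros (map (_∸ z) (filter (_<? l) L))
complementDiagram² [] = 0 , 0 , refl
complementDiagram² {l ∷ L} (_ ∷ L↓) = z , l , (begin
  complementDiagram (complementDiagram (l ∷ L))  ≡⟨ cong complementDiagram (complementDiagram-∷-filter l L) ⟩
  complementDiagram (map (l ∸_) (reverse Y))     ≡⟨ proj₂ ascending ⟩
  dropZeros (map (_∸ z) (reverse (reverse Y)))   ≡⟨ cong (dropZeros ∘ map (_∸ z)) (reverse-involutive Y) ⟩
  dropZeros (map (_∸ z) Y)                       ≡⟨ cong (dropZeros ∘ map (_∸ z)) (filter-reject (_<? l) (<-irrefl refl)) ⟨
  dropZeros (map (_∸ z) (filter (_<? l) (l ∷ L))) ∎)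
  where
  open ≡-Reasoning
  Y = filter (_<? l) L
  ascending = complementDiagram-ascending (reverse Y)
    (AllPairs-reverse⁺ (AllPairs.filter⁺ (_<? l) L↓))
    (All-reverse⁺ (All.map <⇒≤ (All.all-filter (_<? l) L)))
  z = proj₁ ascending

-- The gaps of the double complement

∈-diagramGaps-resp : ∀ {x D E} → D ≡ E → x ∈ diagramGaps D → x ∈ diagramGaps E
∈-diagramGaps-resp {x} = subst ((x ∈_) ∘ diagramGaps)

module Window (p : ℕ → Bool) (z l : ℕ) where

  c : ℕ → ℕ
  c = countBelow p

  windowOf : List ℕ → List ℕ
  windowOf rows = dropZeros (map (_∸ z) (filter (_<? l) rows))

  -- For n = bound S and the z, l of complementDiagram², this is the diagram of S⁽²⁾.
  window : ℕ → List ℕ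
  window n = windowOf (map c (gapsBelow p n))

  WindowGap : ℕ → Set
  WindowGap m = p m ≡ false × z < c m × c m < l

  windowGap? : Decidable WindowGap
  windowGap? m = (p m ≟ᵇ false) ×-dec (z <? c m) ×-dec (c m <? l)

  windowOf-accept : ∀ {r} rs → z < r → r < l → windowOf (r ∷ rs) ≡ (r ∸ z) ∷ windowOf rs
  windowOf-accept rs z<r r<l = trans (cong (dropZeros ∘ map (_∸ z)) (filter-accept (_<? l) r<l))
                                     (dropZeros-accept _ (m<n⇒0<n∸m z<r))

  windowOf-reject : ∀ {r} rs → ¬ (z < r × r < l) → windowOf (r ∷ rs) ≡ windowOf rs
  windowOf-reject {r} rs outside with r <? l
  ... | no  r≮l = cong (dropZeros ∘ map (_∸ z)) (filter-reject (_<? l) r≮l)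
  ... | yes r<l = begin
    windowOf (r ∷ rs)                                  ≡⟨ cong (dropZeros ∘ map (_∸ z)) (filter-accept (_<? l) r<l) ⟩
    dropZeros (r ∸ z ∷ map (_∸ z) (filter (_<? l) rs))  ≡⟨ cong (λ x → dropZeros (x ∷ map (_∸ z) (filter (_<? l) rs))) r∸z≡0 ⟩
    windowOf rs                                        ∎
    where
    open ≡-Reasoning
    r∸z≡0 = m≤n⇒m∸n≡0 (≮⇒≥ (λ z<r → outside (z<r , r<l)))

  window-suc : ∀ {n} → WindowGap n → window (suc n) ≡ (c n ∸ z) ∷ window n
  window-suc (pn , z<c , c<l) = trans (cong (windowOf ∘ map c) (gapsBelow-gap p pn)) (windowOf-accept _ z<c c<l)

  window-suc-¬ : ∀ {n} → ¬ WindowGap n → window (suc n) ≡ window n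
  window-suc-¬ {n} ¬w with p n
  ... | true  = refl
  ... | false = windowOf-reject _ (λ (z<c , c<l) → ¬w (refl , z<c , c<l))

  ∈-window⁻ : ∀ n {x} → x ∈ diagramGaps (window n) →
              ∃[ m ] m < n × WindowGap m × x ≡ c m ∸ z + length (window m)
  ∈-window⁻ (suc n) x∈ with windowGap? n
  ... | no ¬w = map₂ (map₁ m<n⇒m<1+n) (∈-window⁻ n (∈-diagramGaps-resp (window-suc-¬ ¬w) x∈))
  ... | yes w with ∈-diagramGaps-resp (window-suc w) x∈
  ...   | here x≡  = n , ≤-refl , w , x≡
  ...   | there x∈′ = map₂ (map₁ m<n⇒m<1+n) (∈-window⁻ n x∈′)

  ∈-window⁺ : ∀ {m} n → m < n → WindowGap m → c m ∸ z + length (window m) ∈ diagramGaps (window n)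
  ∈-window⁺ {m} (suc n) m<1+n w with m≤n⇒m<n∨m≡n (≤-pred m<1+n)
  ... | inj₂ refl = ∈-diagramGaps-resp (sym (window-suc w)) (here refl)
  ... | inj₁ m<n with windowGap? n
  ...   | yes wn  = ∈-diagramGaps-resp (sym (window-suc wn)) (there (∈-window⁺ n m<n w))
  ...   | no ¬wn  = ∈-diagramGaps-resp (sym (window-suc-¬ ¬wn)) (∈-window⁺ n m<n w)

  anchor-exists : ∀ n {x} → x ∈ diagramGaps (window n) → ∃[ q ] p q ≡ true × c q ≡ z
  anchor-exists n x∈ with ∈-window⁻ n x∈
  ... | m , _ , (_ , z<cm , _) , _ = map₂ proj₂ (countBelow-attains p m z<cm)

  module Anchored {q : ℕ} (q∈ : p q ≡ true) (cq≡z : c q ≡ z) where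

    anchor<windowGap : ∀ {m} → WindowGap m → q < m
    anchor<windowGap {m} (_ , z<cm , _) = countBelow-<⇒< p (subst (_< c m) (sym cq≡z) z<cm)

    windowGap-after-anchor : ∀ {k} → q ≤ k → p k ≡ false → c k < l → WindowGap k
    windowGap-after-anchor {k} q≤k pk ck<l = pk , subst (_< c k) cq≡z (countBelow-member-< p q∈ q<k) , ck<l
      where
      q<k = ≤∧≢⇒< q≤k (λ q≡k → not-¬ q∈ (trans (cong p q≡k) pk))

    window-below-anchor : ∀ {k} → k ≤ q → window k ≡ []
    window-below-anchor {zero}  _   = refl
    window-below-anchor {suc k} k<q =
      trans (window-suc-¬ (λ w → <-asym k<q (anchor<windowGap w))) (window-below-anchor (<⇒≤ k<q))

    offset-step : ∀ {k} → q ≤ k → c (suc k) < l →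
                  c (suc k) + length (window (suc k)) ≡ suc (c k + length (window k))
    offset-step {k} q≤k c<l with windowGap? k
    ... | yes w = trans (cong₂ _+_ (countBelow-gap p (proj₁ w)) (cong length (window-suc w))) (+-suc (c k) _)
    ... | no ¬w = cong₂ _+_ (countBelow-member p k∈) (cong length (window-suc-¬ ¬w))
      where
      k∈ : p k ≡ true
      k∈ = ¬-not (λ pk → ¬w (windowGap-after-anchor q≤k pk (≤-<-trans (countBelow-≤-suc p k) c<l)))

    -- Each k in [q, q + j) is either a member of S, counted in c (q + j) − z,
    -- or a window gap, counted in the length.
    offset : ∀ j → c (q + j) < l → c (q + j) + length (window (q + j)) ≡ j + z
    offset zero _ = begin
      c (q + 0) + length (window (q + 0))   ≡⟨ cong (λ t → c t + length (window t)) (+-identityʳ q) ⟩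
      c q + length (window q)               ≡⟨ cong₂ _+_ cq≡z (cong length (window-below-anchor ≤-refl)) ⟩
      z + 0                                 ≡⟨ +-identityʳ z ⟩
      z                                     ∎
      where open ≡-Reasoning
    offset (suc j) c<l = begin
      c (q + suc j) + length (window (q + suc j))   ≡⟨ cong (λ t → c t + length (window t)) (+-suc q j) ⟩
      c (suc k) + length (window (suc k))           ≡⟨ offset-step (m≤m+n q j) c[1+k]<l ⟩
      suc (c k + length (window k))                 ≡⟨ cong suc (offset j (≤-<-trans (countBelow-≤-suc p k) c[1+k]<l)) ⟩
      suc j + z                                     ∎
      where
      open ≡-Reasoning
      k = q + j
      c[1+k]<l = subst (λ t → c t < l) (+-suc q j) c<l

    windowGap-offset : ∀ {m} → WindowGap m → c m ∸ z + length (window m) ≡ m ∸ q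
    windowGap-offset {m} w@(_ , z<cm , cm<l) = begin
      c m ∸ z + length (window m)                 ≡⟨ +-∸-comm (length (window m)) (<⇒≤ z<cm) ⟨
      c m + length (window m) ∸ z                 ≡⟨ cong (λ t → c t + length (window t) ∸ z) m≡q+j ⟩
      c (q + j) + length (window (q + j)) ∸ z     ≡⟨ cong (_∸ z) (offset j (subst (λ t → c t < l) m≡q+j cm<l)) ⟩
      j + z ∸ z                                   ≡⟨ m+n∸n≡m j z ⟩
      j                                           ∎
      where
      open ≡-Reasoning
      j = m ∸ q
      m≡q+j = sym (m+[n∸m]≡n (<⇒≤ (anchor<windowGap w)))

    shifted-∈-window⁻ : ∀ n {x} → x ∈ diagramGaps (window n) → ∃[ m ] WindowGap m × x ≡ m ∸ q
    shifted-∈-window⁻ n x∈ with ∈-window⁻ n x∈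
    ... | m , _ , w , x≡ = m , w , trans x≡ (windowGap-offset w)

    shifted-∈-window⁺ : ∀ {m} n → m < n → WindowGap m → m ∸ q ∈ diagramGaps (window n)
    shifted-∈-window⁺ n m<n w = subst (_∈ diagramGaps (window n)) (windowGap-offset w) (∈-window⁺ n m<n w)

-- The associated semigroup

module _ (S : NumericalSet) {z l : ℕ}
         (shape : complementDiagram (complementDiagram (youngDiagram S)) ≡ Window.window (mem S) z l (bound S))
         where

  open Window (mem S) z l

  gaps² : List ℕ
  gaps² = diagramGaps (window (bound S))

  mem-complement² : ∀ n → mem (iterComplement 2 S) n ≡ not (elemᵇ n gaps²)
  mem-complement² n = cong (λ D → not (elemᵇ n (diagramGaps D)))
                           (trans (cong complementDiagram (youngDiagram-complement S)) shape)

  windowGap<bound : ∀ {m} → WindowGap m → m < bound S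
  windowGap<bound {m} (m∉S , _) = ≰⇒> (λ B≤m → not-¬ (cofinite S m B≤m) m∉S)

  module _ {a : ℕ} (a+S⊆S : ∀ s → s ∈ₛ S → a + s ∈ₛ S) where

    a∉gaps² : a ∉ gaps²
    a∉gaps² a∈ with anchor-exists (bound S) a∈
    ... | q , q∈ , cq≡z with Anchored.shifted-∈-window⁻ q∈ cq≡z (bound S) a∈
    ... | m , w , a≡m∸q = not-¬ (a+S⊆S q q∈) (trans (cong (mem S) a+q≡m) (proj₁ w))
      where
      a+q≡m = trans (cong (_+ q) a≡m∸q) (m∸n+n≡m (<⇒≤ (Anchored.anchor<windowGap q∈ cq≡z w)))

    gaps²-shift : ∀ {s} → a + s ∈ gaps² → s ∈ gaps²
    gaps²-shift {s} a+s∈ with anchor-exists (bound S) a+s∈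
    ... | q , q∈ , cq≡z with Anchored.shifted-∈-window⁻ q∈ cq≡z (bound S) a+s∈
    ... | m , w@(m∉S , _ , cm<l) , a+s≡m∸q =
      subst (_∈ gaps²) (m+n∸m≡n q s) (shifted-∈-window⁺ (bound S) (windowGap<bound g-gap) g-gap)
      where
      open Anchored q∈ cq≡z
      open ≡-Reasoning
      g = q + s
      a+g≡m : a + g ≡ m
      a+g≡m = begin
        a + (q + s)   ≡⟨ cong (a +_) (+-comm q s) ⟩
        a + (s + q)   ≡⟨ +-assoc a s q ⟨
        a + s + q     ≡⟨ cong (_+ q) a+s≡m∸q ⟩
        m ∸ q + q     ≡⟨ m∸n+n≡m (<⇒≤ (anchor<windowGap w)) ⟩
        m             ∎
      g∉S : mem S g ≡ false
      g∉S = ¬-not (λ g∈ → not-¬ (a+S⊆S g g∈) (trans (cong (mem S) a+g≡m) m∉S))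
      g-gap : WindowGap g
      g-gap = windowGap-after-anchor (m≤m+n q s) g∉S
                (≤-<-trans (countBelow-mono (mem S) (subst (g ≤_) a+g≡m (m≤n+m g a))) cm<l)

    ∈A-complement² : a ∈A iterComplement 2 S
    ∈A-complement² =
      trans (mem-complement² a) (∉⇒not-elemᵇ gaps² a∉gaps²) ,
      λ s s∈ → trans (mem-complement² (a + s))
                     (∉⇒not-elemᵇ gaps² (not-elemᵇ⇒∉ (trans (sym (mem-complement² s)) s∈) ∘ gaps²-shift))

-- a ∈ S is not needed: it is the case s = 0 of a + S ⊆ S.
proposition5p3 : (S : NumericalSet) (a : ℕ) → a ∈A S → a ∈A iterComplement 2 S
proposition5p3 S a (_ , a+S⊆S) with complementDiagram² (youngDiagram-nonIncreasing S)
... | z , l , shape = ∈A-complement² S {z} {l} shape a+S⊆S
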